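{- Let $\eta:A^*\to A^*$ be a substitution and $u\in A^{\mathbb{Z}}$ a two-sided periodic point of $\eta$ with growing seed $s=u_{ -1}|u_0$. Let $w\in\mathcal{L}(\mathcal{A}_{\eta,s})$. Then for every integer $i\ge0$, \[ \mathcal{A}_{\eta,s}(w)=\begin{cases}\mathcal{A}_{\eta,s}(0\,(\mathtt{W}_{\min})^i\,v), & \text{if } w=0v,\\ \mathcal{A}_{\eta,s}(1\,(\mathtt{W}_{\max})^i\,v), & \text{if } w=1v.\end{cases} \]
   Context: $A$ is a finite alphabet, $A^*$ the finite words, $|w|$ the length, $w[i]$ the $i$-th letter (from $0$). A substitution is a morphism $\eta:A^*\to A^*$ with $\eta(a)$ nonempty for all $a$ and some letter growing ($|\eta^k(a)|\to\infty$). $\eta$ acts on $u\in A^{\mathbb{Z}}$ by $\eta(\cdots u_{ -1}|u_0\cdots)=\cdots\eta(u_{ -2})\eta(u_{ -1})|\eta(u_0)\eta(u_1)\cdots$ ($|$ separating positions $-1$ and $0$); $u$ is a periodic point if $\eta^p(u)=u$ for some $p\ge1$, its period is the least such $p$; the seed $u_{ -1}|u_0$ is growing if both letters are growing. Let $\mathcal{D}=\{0,\dots,\max_c|\eta(c)|-1\}$; juxtaposition of words over $\mathcal{D}$ is concatenation. A sequence $(m_i,a_i)_{i=0,\dots,k}$ in $A^*\times A$ is $x$-admissible if $m_{i-1}a_{i-1}$ is a prefix of $\eta(a_i)$ for $1\le i\le k$ and $m_ka_k$ is a prefix of $\eta(x)$; for $p\ge1$, $x\in A$, $0\le n<|\eta^p(x)|$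 there is a unique $x$-admissible $(m_i,a_i)_{i=0,\dots,p-1}$ with $n=\sum_j|\eta^j(m_j)|$, and $\mathrm{tail}_{\eta,p,x}(n)=|m_{p-1}|\cdots|m_0|\in\mathcal{D}^p$. With $p$ the period of $u$, set $\mathtt{W}_{\min}=\mathrm{tail}_{\eta,p,u_0}(0)=0^p$ and $\mathtt{W}_{\max}=\mathrm{tail}_{\eta,p,u_{ -1}}(|\eta^p(u_{ -1})|-1)$. The automaton $\mathcal{A}_{\eta,s}$ has states $A\cup\{\mathtt{start}\}$, initial state $\mathtt{start}$, accepting states $A$, and partial transitions $\delta(\mathtt{start},0)=u_0$, $\delta(\mathtt{start},1)=u_{ -1}$, $\delta(c,i)=\eta(c)[i]$ for $c\in A$ and $0\le i<|\eta(c)|$, extended to words; $\mathcal{A}_{\eta,s}(w)=\delta(\mathtt{start},w)$ and $\mathcal{L}(\mathcal{A}_{\eta,s})$ is the set of $w\in\mathcal{D}^*$ with $\delta(\mathtt{start},w)$ defined and in $A$. -}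

module Defs where

open import Data.Nat using (ℕ; zero; suc; _+_; _∸_; _≤_; _<_; _⊔_)
open import Data.Integer using (ℤ; +_; -[1+_])
open import Data.Fin using (Fin)
open import Data.List using (List; []; _∷_; _++_; length; concatMap; map; reverse; foldr; allFin; replicate; concat)
open import Data.List.NonEmpty using (List⁺; _∷_; head; tail; toList)
import Data.List.NonEmpty as L⁺
open import Data.List.Relation.Unary.All using (All)
open import Data.Maybe using (Maybe; just; nothing)
import Data.Maybe as Maybe
open import Data.Product using (Σ; ∃; _×_; _,_; proj₁)
open import Relation.Binary.PropositionalEquality using (_≡_)
open import Relation.Nullary using (¬_)

-- A substitution on the finite alphabet Fin k is given by its images on letters;
-- images are nonempty, hence List⁺.
Subst : ℕ → Set
Subst k = Fin k → List⁺ (Fin k)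

ext : ∀ {k} → Subst k → List (Fin k) → List (Fin k)
ext η = concatMap (λ c → toList (η c))

extPow : ∀ {k} → Subst k → ℕ → List (Fin k) → List (Fin k)
extPow η zero w = w
extPow η (suc j) w = ext η (extPow η j w)

Growing : ∀ {k} → Subst k → Fin k → Set
Growing η a = ∀ N → ∃ λ j → N ≤ length (extPow η j (a ∷ []))

-- η is a substitution: some letter grows (nonemptiness is built into List⁺)
IsSubstitution : ∀ {k} → Subst k → Set
IsSubstitution η = ∃ λ a → Growing η a

-- reading position n of the infinite concatenation blk 0 · blk 1 · blk 2 ⋯
mutual
  readBlocks : {B : Set} → (ℕ → List⁺ B) → ℕ → ℕ → B
  readBlocks blk k zero = head (blk k)
  readBlocks blk k (suc n) = walk blk k (tail (blk k)) n

  walk : {B : Set} → (ℕ → List⁺ B) → ℕ → List B → ℕ → B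
  walk blk k [] n = readBlocks blk (suc k) n
  walk blk k (x ∷ xs) zero = x
  walk blk k (x ∷ xs) (suc n) = walk blk k xs n

-- action of η on A^ℤ:  ⋯η(u₋₂)η(u₋₁)|η(u₀)η(u₁)⋯
act : ∀ {k} → Subst k → (ℤ → Fin k) → (ℤ → Fin k)
act η u (+ n) = readBlocks (λ j → η (u (+ j))) 0 n
act η u -[1+ n ] = readBlocks (λ j → L⁺.reverse (η (u -[1+ j ]))) 0 n

actPow : ∀ {k} → Subst k → ℕ → (ℤ → Fin k) → (ℤ → Fin k)
actPow η zero u = u
actPow η (suc p) u = act η (actPow η p u)

FixedBy : ∀ {k} → Subst k → ℕ → (ℤ → Fin k) → Set
FixedBy η p u = ∀ z → actPow η p u z ≡ u z

IsPeriod : ∀ {k} → Subst k → (ℤ → Fin k) → ℕ → Set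
IsPeriod η u p = 1 ≤ p × FixedBy η p u × (∀ q → 1 ≤ q → q < p → ¬ FixedBy η q u)

-- digit alphabet 𝒟 = {0,…,max_c |η(c)| - 1}
maxLen : ∀ {k} → Subst k → ℕ
maxLen {k} η = foldr (λ c m → L⁺.length (η c) ⊔ m) 0 (allFin k)

InD : ∀ {k} → Subst k → ℕ → Set
InD η d = d < maxLen η

nth : {B : Set} → List B → ℕ → Maybe B
nth [] i = nothing
nth (x ∷ xs) zero = just x
nth (x ∷ xs) (suc i) = nth xs i

data State (k : ℕ) : Set where
  start : State k
  st    : Fin k → State k

δ : ∀ {k} → Subst k → (ℤ → Fin k) → State k → ℕ → Maybe (State k)
δ η u start zero = just (st (u (+ 0)))
δ η u start (suc zero) = just (st (u -[1+ 0 ]))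
δ η u start (suc (suc _)) = nothing
δ η u (st c) i = Maybe.map st (nth (toList (η c)) i)

δ* : ∀ {k} → Subst k → (ℤ → Fin k) → State k → List ℕ → Maybe (State k)
δ* η u q [] = just q
δ* η u q (d ∷ w) = Maybe.maybe (λ q' → δ* η u q' w) nothing (δ η u q d)

runA : ∀ {k} → Subst k → (ℤ → Fin k) → List ℕ → Maybe (State k)
runA η u w = δ* η u start w

InL : ∀ {k} → Subst k → (ℤ → Fin k) → List ℕ → Set
InL η u w = All (InD η) w × ∃ λ a → runA η u w ≡ just (st a)

Prefix : {B : Set} → List B → List B → Set
Prefix {B} xs ys = ∃ λ (zs : List B) → xs ++ zs ≡ ys

-- x-admissible sequences (m₀,a₀),…,(m_k,a_k)  (listed from index 0)
data Admissible {k} (η : Subst k) (x : Fin k) : List (List (Fin k) × Fin k) → Set where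
  last : ∀ m a → Prefix (m ++ a ∷ []) (toList (η x)) → Admissible η x ((m , a) ∷ [])
  more : ∀ m a m' a' rest → Prefix (m ++ a ∷ []) (toList (η a')) →
         Admissible η x ((m' , a') ∷ rest) → Admissible η x ((m , a) ∷ (m' , a') ∷ rest)

weightFrom : ∀ {k} → Subst k → ℕ → List (List (Fin k) × Fin k) → ℕ
weightFrom η j [] = 0
weightFrom η j ((m , a) ∷ r) = length (extPow η j m) + weightFrom η (suc j) r

tailWord : ∀ {k} → List (List (Fin k) × Fin k) → List ℕ
tailWord seq = reverse (map (λ ma → length (proj₁ ma)) seq)

-- W is tail_{η,p,x}(n): given by the (unique) x-admissible sequence of length p with weight n
IsTail : ∀ {k} → Subst k → ℕ → Fin k → ℕ → List ℕ → Set
IsTail {k} η p x n W = ∃ λ (seq : List (List (Fin k) × Fin k)) →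
  Admissible η x seq × length seq ≡ p × weightFrom η 0 seq ≡ n × W ≡ tailWord seq

Wmin : ℕ → List ℕ
Wmin p = replicate p 0

pow : List ℕ → ℕ → List ℕ
pow W i = concat (replicate i W)

{-# OPTIONS --safe #-}
-- Both W_min and W_max label loops of the automaton, at u₀ and at u₋₁ respectively, so
-- inserting any power of them after the first digit does not change the state reached.
-- Reading 0 from c leads to the first letter of η(c), so 0^p leads from u₀ to the first
-- letter of η^p(u₀), which is u₀ by periodicity. Reading tail_{η,p,x}(n) from x leads to
-- a₀; the weight n = |η^p(x)| - 1 is the largest possible only when every m_j a_j is all of
-- η(a_{j+1}), i.e. a₀ is the last letter of η^p(x), which is u₋₁ again by periodicity.
module Submission where

open import Defs
open import Data.Nat using (ℕ; zero; suc; _∸_; _+_; _≤_; _<_; s≤s; z≤n)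
open import Data.Nat.Properties
open import Data.Nat.GeneralisedArithmetic using (fold; iterate; iterate-is-fold)
open import Data.Integer using (ℤ; +_; -[1+_])
open import Data.Fin using (Fin)
open import Data.List using (List; []; _∷_; _++_; length; reverse; map; replicate)
open import Data.List.Properties using (++-assoc; length-++; reverse-++; unfold-reverse; ++-identityʳ)
open import Data.List.NonEmpty using (List⁺; _∷_; head; toList)
import Data.List.NonEmpty as L⁺
import Data.Vec as Vec
import Data.Vec.Properties as Vec
open import Data.Maybe using (just)
open import Data.Empty using (⊥-elim)
open import Data.Product using (_×_; _,_; proj₁)
open import Function using (_∘_)
open import Relation.Binary.PropositionalEquality

toList-reverse⁺ : ∀ {B : Set} (xs : List⁺ B) → toList (L⁺.reverse xs) ≡ reverse (toList xs)
toList-reverse⁺ (x ∷ xs) = begin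
  toList (L⁺.fromVec (Vec.reverse (x Vec.∷ Vec.fromList xs)))  ≡⟨ toList-fromVec (Vec.reverse (x Vec.∷ Vec.fromList xs)) ⟩
  Vec.toList (Vec.reverse (x Vec.∷ Vec.fromList xs))          ≡⟨ Vec.toList-reverse (x Vec.∷ Vec.fromList xs) ⟩
  reverse (x ∷ Vec.toList (Vec.fromList xs))                  ≡⟨ cong (λ ys → reverse (x ∷ ys)) (Vec.toList∘fromList xs) ⟩
  reverse (x ∷ xs)                                            ∎
  where
  open ≡-Reasoning
  toList-fromVec : ∀ {n} (v : Vec.Vec _ (suc n)) → toList (L⁺.fromVec v) ≡ Vec.toList v
  toList-fromVec (y Vec.∷ v) = refl

head-∷ʳ-reverse⁺ : ∀ {B : Set} (xs : List⁺ B) m a → m ++ a ∷ [] ≡ toList xs → head (L⁺.reverse xs) ≡ a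
head-∷ʳ-reverse⁺ xs m a eq = head-toList (L⁺.reverse xs) (begin
  toList (L⁺.reverse xs)   ≡⟨ toList-reverse⁺ xs ⟩
  reverse (toList xs)      ≡⟨ cong reverse eq ⟨
  reverse (m ++ a ∷ [])    ≡⟨ reverse-++ m (a ∷ []) ⟩
  a ∷ reverse m            ∎)
  where
  open ≡-Reasoning
  head-toList : ∀ ys {r} → toList ys ≡ a ∷ r → head ys ≡ a
  head-toList (y ∷ ys) refl = refl

nth-length-prefix : ∀ {B : Set} m (a : B) l → Prefix (m ++ a ∷ []) l → nth l (length m) ≡ just a
nth-length-prefix []      a l (r , refl) = refl
nth-length-prefix (x ∷ m) a l (r , refl) = nth-length-prefix m a _ (r , refl)

≤-+-≡-split : ∀ {a b c d} → a ≤ b → b + c ≤ d → a + c ≡ d → a ≡ b × b + c ≡ d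
≤-+-≡-split {a} {b} {c} {d} a≤b b+c≤d a+c≡d = a≡b , trans (cong (_+ c) (sym a≡b)) a+c≡d
  where
  a≡b : a ≡ b
  a≡b = ≤-antisym a≤b (+-cancelʳ-≤ c b a (subst (b + c ≤_) (sym a+c≡d) b+c≤d))

module _ {k : ℕ} (η : Subst k) where

  ext-++ : ∀ (xs ys : List (Fin k)) → ext η (xs ++ ys) ≡ ext η xs ++ ext η ys
  ext-++ []       ys = refl
  ext-++ (x ∷ xs) ys = trans (cong (toList (η x) ++_) (ext-++ xs ys)) (sym (++-assoc (toList (η x)) (ext η xs) (ext η ys)))

  extPow-++ : ∀ j (xs ys : List (Fin k)) → extPow η j (xs ++ ys) ≡ extPow η j xs ++ extPow η j ys
  extPow-++ zero    xs ys = refl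
  extPow-++ (suc j) xs ys = trans (cong (ext η) (extPow-++ j xs ys)) (ext-++ (extPow η j xs) (extPow η j ys))

  extPow-suc : ∀ j w → extPow η (suc j) w ≡ extPow η j (ext η w)
  extPow-suc zero    w = refl
  extPow-suc (suc j) w = cong (ext η) (extPow-suc j w)

  lengthPow : ℕ → List (Fin k) → ℕ
  lengthPow j w = length (extPow η j w)

  lengthPow-++ : ∀ j xs ys → lengthPow j (xs ++ ys) ≡ lengthPow j xs + lengthPow j ys
  lengthPow-++ j xs ys = trans (cong length (extPow-++ j xs ys)) (length-++ (extPow η j xs))

  lengthPow-suc-[] : ∀ j c → lengthPow (suc j) (c ∷ []) ≡ lengthPow j (toList (η c))
  lengthPow-suc-[] j c = cong length (trans (extPow-suc j (c ∷ [])) (cong (extPow η j) (++-identityʳ (toList (η c)))))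

  lengthPow-∷-pos : ∀ j c w → 0 < lengthPow j (c ∷ w)
  lengthPow-∷-pos zero    c w = s≤s z≤n
  lengthPow-∷-pos (suc j) c w = subst (0 <_) (sym (cong length (extPow-suc j (c ∷ w))))
    (lengthPow-∷-pos j (head (η c)) (L⁺.tail (η c) ++ ext η w))

  firstLetter : Fin k → Fin k
  firstLetter c = head (η c)

  lastLetter : Fin k → Fin k
  lastLetter c = head (L⁺.reverse (η c))

  lengthPow-prefix : ∀ j m a r c → (m ++ a ∷ []) ++ r ≡ toList (η c) →
                     lengthPow (suc j) (c ∷ []) ≡ (lengthPow j (a ∷ []) + lengthPow j m) + lengthPow j r
  lengthPow-prefix j m a r c eq = begin
    lengthPow (suc j) (c ∷ [])                               ≡⟨ lengthPow-suc-[] j c ⟩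
    lengthPow j (toList (η c))                               ≡⟨ cong (lengthPow j) eq ⟨
    lengthPow j ((m ++ a ∷ []) ++ r)                         ≡⟨ lengthPow-++ j (m ++ a ∷ []) r ⟩
    lengthPow j (m ++ a ∷ []) + lengthPow j r                ≡⟨ cong (_+ lengthPow j r) (lengthPow-++ j m (a ∷ [])) ⟩
    (lengthPow j m + lengthPow j (a ∷ [])) + lengthPow j r   ≡⟨ cong (_+ lengthPow j r) (+-comm (lengthPow j m) _) ⟩
    (lengthPow j (a ∷ []) + lengthPow j m) + lengthPow j r   ∎
    where open ≡-Reasoning

  prefix-lengthPow-≤ : ∀ j m a c → Prefix (m ++ a ∷ []) (toList (η c)) →
                       lengthPow j (a ∷ []) + lengthPow j m ≤ lengthPow (suc j) (c ∷ [])
  prefix-lengthPow-≤ j m a c (r , eq) =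
    subst (_ ≤_) (sym (lengthPow-prefix j m a r c eq)) (m≤m+n _ (lengthPow j r))

  prefix-lengthPow-≡⇒lastLetter : ∀ j m a c → Prefix (m ++ a ∷ []) (toList (η c)) →
                       lengthPow j (a ∷ []) + lengthPow j m ≡ lengthPow (suc j) (c ∷ []) → a ≡ lastLetter c
  prefix-lengthPow-≡⇒lastLetter j m a c ([] , eq) _ =
    sym (head-∷ʳ-reverse⁺ (η c) m a (trans (sym (++-identityʳ (m ++ a ∷ []))) eq))
  prefix-lengthPow-≡⇒lastLetter j m a c (x ∷ r , eq) tight =
    ⊥-elim (<⇒≢ (m<m+n _ (lengthPow-∷-pos j x r)) (trans tight (lengthPow-prefix j m a (x ∷ r) c eq)))

  weightFrom-∷ : ∀ j m a rest → lengthPow j (a ∷ []) + weightFrom η j ((m , a) ∷ rest) ≡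
                 (lengthPow j (a ∷ []) + lengthPow j m) + weightFrom η (suc j) rest
  weightFrom-∷ j m a rest = sym (+-assoc (lengthPow j (a ∷ [])) (lengthPow j m) (weightFrom η (suc j) rest))

  lengthPow-+-suc : ∀ i j w → lengthPow (i + suc j) w ≡ lengthPow (suc i + j) w
  lengthPow-+-suc i j w = cong (λ n → lengthPow n w) (+-suc i j)

  admissible-weight-≤ : ∀ {x m a rest} j → Admissible η x ((m , a) ∷ rest) →
    lengthPow j (a ∷ []) + weightFrom η j ((m , a) ∷ rest) ≤ lengthPow (j + length ((m , a) ∷ rest)) (x ∷ [])
  admissible-weight-≤ {x} {m} {a} j (last .m .a pre) = begin
    lengthPow j (a ∷ []) + weightFrom η j ((m , a) ∷ [])    ≡⟨ weightFrom-∷ j m a [] ⟩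
    (lengthPow j (a ∷ []) + lengthPow j m) + 0               ≡⟨ +-identityʳ _ ⟩
    lengthPow j (a ∷ []) + lengthPow j m                     ≤⟨ prefix-lengthPow-≤ j m a x pre ⟩
    lengthPow (suc j) (x ∷ [])                               ≡⟨ cong (λ n → lengthPow n (x ∷ [])) (+-comm j 1) ⟨
    lengthPow (j + 1) (x ∷ [])                               ∎
    where open ≤-Reasoning
  admissible-weight-≤ {x} {m} {a} j (more .m .a m' a' rest pre adm) = begin
    lengthPow j (a ∷ []) + weightFrom η j ((m , a) ∷ (m' , a') ∷ rest)                 ≡⟨ weightFrom-∷ j m a ((m' , a') ∷ rest) ⟩
    (lengthPow j (a ∷ []) + lengthPow j m) + weightFrom η (suc j) ((m' , a') ∷ rest)   ≤⟨ +-monoˡ-≤ _ (prefix-lengthPow-≤ j m a a' pre) ⟩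
    lengthPow (suc j) (a' ∷ []) + weightFrom η (suc j) ((m' , a') ∷ rest)              ≤⟨ admissible-weight-≤ (suc j) adm ⟩
    lengthPow (suc j + suc (length rest)) (x ∷ [])                                     ≡⟨ lengthPow-+-suc j (suc (length rest)) (x ∷ []) ⟨
    lengthPow (j + suc (suc (length rest))) (x ∷ [])                                   ∎
    where open ≤-Reasoning

  admissible-weight-≡⇒lastLetter : ∀ {x m a rest} j → Admissible η x ((m , a) ∷ rest) →
    lengthPow j (a ∷ []) + weightFrom η j ((m , a) ∷ rest) ≡ lengthPow (j + length ((m , a) ∷ rest)) (x ∷ []) →
    a ≡ fold x lastLetter (length ((m , a) ∷ rest))
  admissible-weight-≡⇒lastLetter {x} {m} {a} j (last .m .a pre) tight =
    prefix-lengthPow-≡⇒lastLetter j m a x pre (begin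
      lengthPow j (a ∷ []) + lengthPow j m                 ≡⟨ +-identityʳ _ ⟨
      (lengthPow j (a ∷ []) + lengthPow j m) + 0           ≡⟨ weightFrom-∷ j m a [] ⟨
      lengthPow j (a ∷ []) + weightFrom η j ((m , a) ∷ []) ≡⟨ tight ⟩
      lengthPow (j + 1) (x ∷ [])                           ≡⟨ cong (λ n → lengthPow n (x ∷ [])) (+-comm j 1) ⟩
      lengthPow (suc j) (x ∷ [])                           ∎)
    where open ≡-Reasoning
  admissible-weight-≡⇒lastLetter {x} {m} {a} j (more .m .a m' a' rest pre adm) tight
    with ≤-+-≡-split (prefix-lengthPow-≤ j m a a' pre) (admissible-weight-≤ (suc j) adm) regrouped
    where
    regrouped : (lengthPow j (a ∷ []) + lengthPow j m) + weightFrom η (suc j) ((m' , a') ∷ rest) ≡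
                lengthPow (suc j + suc (length rest)) (x ∷ [])
    regrouped = trans (sym (weightFrom-∷ j m a ((m' , a') ∷ rest)))
                      (trans tight (lengthPow-+-suc j (suc (length rest)) (x ∷ [])))
  ... | head-tight , rest-tight = trans (prefix-lengthPow-≡⇒lastLetter j m a a' pre head-tight)
                                        (cong lastLetter (admissible-weight-≡⇒lastLetter (suc j) adm rest-tight))

  maximal-weight⇒lastLetter : ∀ {x m a rest} → Admissible η x ((m , a) ∷ rest) →
    weightFrom η 0 ((m , a) ∷ rest) ≡ lengthPow (length ((m , a) ∷ rest)) (x ∷ []) ∸ 1 →
    a ≡ fold x lastLetter (length ((m , a) ∷ rest))
  maximal-weight⇒lastLetter {x} {rest = rest} adm weight = admissible-weight-≡⇒lastLetter 0 adm
    (trans (cong suc weight) (m+[n∸m]≡n (lengthPow-∷-pos (suc (length rest)) x [])))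

  actPow-0 : ∀ u n → actPow η n u (+ 0) ≡ fold (u (+ 0)) firstLetter n
  actPow-0 u zero    = refl
  actPow-0 u (suc n) = cong firstLetter (actPow-0 u n)

  actPow-[-1] : ∀ u n → actPow η n u -[1+ 0 ] ≡ fold (u -[1+ 0 ]) lastLetter n
  actPow-[-1] u zero    = refl
  actPow-[-1] u (suc n) = cong lastLetter (actPow-[-1] u n)

  module _ (u : ℤ → Fin k) where

    δ*-++ : ∀ {q q'} xs ys → δ* η u q xs ≡ just q' → δ* η u q (xs ++ ys) ≡ δ* η u q' ys
    δ*-++ []       ys refl = refl
    δ*-++ {q} (d ∷ xs) ys run with δ η u q d
    ... | just q'' = δ*-++ xs ys run

    δ*-pow-++ : ∀ {q} W → δ* η u q W ≡ just q → ∀ i v → δ* η u q (pow W i ++ v) ≡ δ* η u q v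
    δ*-pow-++ W loop zero    v = refl
    δ*-pow-++ W loop (suc i) v = begin
      δ* η u _ ((W ++ pow W i) ++ v)   ≡⟨ cong (δ* η u _) (++-assoc W (pow W i) v) ⟩
      δ* η u _ (W ++ pow W i ++ v)     ≡⟨ δ*-++ W (pow W i ++ v) loop ⟩
      δ* η u _ (pow W i ++ v)          ≡⟨ δ*-pow-++ W loop i v ⟩
      δ* η u _ v                       ∎
      where open ≡-Reasoning

    δ*-replicate-0 : ∀ n c → δ* η u (st c) (replicate n 0) ≡ just (st (iterate firstLetter c n))
    δ*-replicate-0 zero    c = refl
    δ*-replicate-0 (suc n) c = δ*-replicate-0 n (firstLetter c)

    δ*-prefix : ∀ {c m a} → Prefix (m ++ a ∷ []) (toList (η c)) → δ* η u (st c) (length m ∷ []) ≡ just (st a)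
    δ*-prefix {c} {m} {a} pre rewrite nth-length-prefix m a (toList (η c)) pre = refl

    δ*-tailWord : ∀ {x m a rest} → Admissible η x ((m , a) ∷ rest) →
                  δ* η u (st x) (tailWord ((m , a) ∷ rest)) ≡ just (st a)
    δ*-tailWord (last _ _ pre) = δ*-prefix pre
    δ*-tailWord {x} {m} {a} (more .m .a m' a' rest pre adm) = begin
      δ* η u (st x) (tailWord ((m , a) ∷ (m' , a') ∷ rest))         ≡⟨ cong (δ* η u (st x)) (unfold-reverse (length m) digits) ⟩
      δ* η u (st x) (tailWord ((m' , a') ∷ rest) ++ length m ∷ [])  ≡⟨ δ*-++ (tailWord ((m' , a') ∷ rest)) _ (δ*-tailWord adm) ⟩
      δ* η u (st a') (length m ∷ [])                                ≡⟨ δ*-prefix pre ⟩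
      just (st a)                                                   ∎
      where
      open ≡-Reasoning
      digits : List ℕ
      digits = map (λ ma → length (proj₁ ma)) ((m' , a') ∷ rest)

    Wmin-loop : ∀ p → FixedBy η p u → δ* η u (st (u (+ 0))) (Wmin p) ≡ just (st (u (+ 0)))
    Wmin-loop p fixed = begin
      δ* η u (st (u (+ 0))) (replicate p 0)           ≡⟨ δ*-replicate-0 p (u (+ 0)) ⟩
      just (st (iterate firstLetter (u (+ 0)) p))     ≡⟨ cong (just ∘ st) (iterate-is-fold (u (+ 0)) firstLetter p) ⟨
      just (st (fold (u (+ 0)) firstLetter p))        ≡⟨ cong (just ∘ st) (actPow-0 u p) ⟨
      just (st (actPow η p u (+ 0)))                  ≡⟨ cong (just ∘ st) (fixed (+ 0)) ⟩
      just (st (u (+ 0)))                             ∎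
      where open ≡-Reasoning

    maximal-tail-loop : ∀ {m a rest} → let seq = (m , a) ∷ rest; x = u -[1+ 0 ] in
      Admissible η x seq → weightFrom η 0 seq ≡ lengthPow (length seq) (x ∷ []) ∸ 1 →
      FixedBy η (length seq) u → δ* η u (st x) (tailWord seq) ≡ just (st x)
    maximal-tail-loop {m} {a} {rest} adm weight fixed = begin
      δ* η u (st (u -[1+ 0 ])) (tailWord ((m , a) ∷ rest))   ≡⟨ δ*-tailWord adm ⟩
      just (st a)                                            ≡⟨ cong (just ∘ st) (maximal-weight⇒lastLetter adm weight) ⟩
      just (st (fold (u -[1+ 0 ]) lastLetter p))             ≡⟨ cong (just ∘ st) (actPow-[-1] u p) ⟨
      just (st (actPow η p u -[1+ 0 ]))                      ≡⟨ cong (just ∘ st) (fixed -[1+ 0 ]) ⟩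
      just (st (u -[1+ 0 ]))                                 ∎
      where
      open ≡-Reasoning
      p : ℕ
      p = length ((m , a) ∷ rest)

lemma17 : ∀ {k} (η : Subst k) → IsSubstitution η →
          (u : ℤ → Fin k) (p : ℕ) → IsPeriod η u p →
          Growing η (u -[1+ 0 ]) → Growing η (u (+ 0)) →
          (Wmax : List ℕ) →
          IsTail η p (u -[1+ 0 ]) (length (extPow η p (u -[1+ 0 ] ∷ [])) ∸ 1) Wmax →
          (w : List ℕ) → InL η u w → (i : ℕ) →
          ((v : List ℕ) → w ≡ 0 ∷ v → runA η u w ≡ runA η u (0 ∷ pow (Wmin p) i ++ v)) ×
          ((v : List ℕ) → w ≡ 1 ∷ v → runA η u w ≡ runA η u (1 ∷ pow Wmax i ++ v))
lemma17 η _ u p (_ , fixed , _) _ _ _ (seq@(_ ∷ _) , adm , refl , weight , refl) _ _ i =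
  (λ { v refl → sym (δ*-pow-++ η u (Wmin p) (Wmin-loop η u p fixed) i v) }) ,
  (λ { v refl → sym (δ*-pow-++ η u (tailWord seq) (maximal-tail-loop η u adm weight fixed) i v) })
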